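{- Let $A$ be an out-arborescence with $n$ nodes, $k$ out-leaves and root $r$, let $T$ be a tournament on $m=n+k-1$ vertices, and let $\sigma=(v_1,v_2,\ldots,v_m)$ be a local median order of $T$. Then there is an embedding $\phi$ of $A$ in $T$ (an injective map $V(A)\to V(T)$ sending every arc $uv$ of $A$ to an arc $\phi(u)\phi(v)$ of $T$) such that $\phi(r)=v_1$.
   Context: A tournament is an orientation of a complete graph; $u$ dominates $v$ if $uv$ is an arc. An out-arborescence is an oriented tree in which all arcs are oriented away from a fixed vertex, the root. An out-leaf is a node of in-degree $1$ and out-degree $0$. A local median order of a tournament $T$ is an ordering $(v_1,\dots,v_m)$ of its vertices such that for all $1\le i<j\le m$, the vertex $v_i$ dominates at least half of the vertices $v_{i+1},\dots,v_j$, and $v_j$ is dominated by at least half of the vertices $v_i,\dots,v_{j-1}$. -}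

module Defs where

open import Data.Nat using (ℕ; zero; suc; _+_; _*_; _∸_; _≤_; _<ᵇ_; _≤ᵇ_)
open import Data.Bool using (Bool; true; false; not; _∧_; if_then_else_)
open import Data.Fin using (Fin; toℕ)
open import Data.Fin.Properties using (all?; _≟_)
open import Data.List using (List; length; filter)
open import Data.List.Base using (allFin)
open import Data.Product using (∃; _×_)
open import Data.Empty using (⊥)
open import Relation.Nullary using (¬_; Dec; yes; no)
open import Relation.Nullary.Decidable using (_×-dec_; ¬?)
open import Relation.Binary.PropositionalEquality using (_≡_; _≢_)
open import Data.Fin.Permutation using (Permutation′; _⟨$⟩ʳ_)
open import Function using (_∘_)

iter : ∀ {A : Set} → ℕ → (A → A) → A → A
iter zero    f x = x
iter (suc k) f x = f (iter k f x)

-- An out-arborescence on node set Fin n, given by its root and a parent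
-- function: for a non-root node v, the unique arc entering v is (parent v , v).
-- The value of parent at the root is irrelevant.  Every node reaches the root
-- by iterating parent (so the underlying graph is a tree, oriented away from
-- the root).
record OutArborescence (n : ℕ) : Set where
  field
    root     : Fin n
    parent   : Fin n → Fin n
    reaches  : ∀ v → ∃ λ k → iter k parent v ≡ root

Arc : ∀ {n} → OutArborescence n → Fin n → Fin n → Set
Arc A u v = (v ≢ OutArborescence.root A) × (OutArborescence.parent A v ≡ u)

arc? : ∀ {n} (A : OutArborescence n) u v → Dec (Arc A u v)
arc? A u v = ¬? (v ≟ OutArborescence.root A) ×-dec (OutArborescence.parent A v ≟ u)

-- out-leaf: in-degree 1 (i.e. not the root) and out-degree 0
IsOutLeaf : ∀ {n} → OutArborescence n → Fin n → Set
IsOutLeaf A v = (v ≢ OutArborescence.root A) × (∀ w → ¬ Arc A v w)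

isOutLeaf? : ∀ {n} (A : OutArborescence n) v → Dec (IsOutLeaf A v)
isOutLeaf? A v = ¬? (v ≟ OutArborescence.root A) ×-dec all? (λ w → ¬? (arc? A v w))

numOutLeaves : ∀ {n} → OutArborescence n → ℕ
numOutLeaves {n} A = length (filter (isOutLeaf? A) (allFin n))

count : ∀ {m} → (Fin m → Bool) → ℕ
count {m} p = length (filter (λ x → p x Data.Bool.≟ true) (allFin m))

-- A tournament on vertex set Fin m: dom u v ≡ true means u dominates v.
record Tournament (m : ℕ) : Set where
  field
    dom       : Fin m → Fin m → Bool
    irrefl    : ∀ u → dom u u ≡ false
    tournament : ∀ u v → u ≢ v → dom u v ≡ not (dom v u)

-- σ ⟨$⟩ʳ i is the vertex in position i (positions 0..m-1, i.e. v_{i+1}).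
IsLocalMedianOrder : ∀ {m} → Tournament m → Permutation′ m → Set
IsLocalMedianOrder {m} T σ =
  ∀ (i j : Fin m) → toℕ i Data.Nat.< toℕ j →
    ((toℕ j ∸ toℕ i) ≤ 2 * count (λ l → (toℕ i <ᵇ toℕ l) ∧ (toℕ l ≤ᵇ toℕ j)
                                          ∧ dom (σ ⟨$⟩ʳ i) (σ ⟨$⟩ʳ l)))
    × ((toℕ j ∸ toℕ i) ≤ 2 * count (λ l → (toℕ i ≤ᵇ toℕ l) ∧ (toℕ l <ᵇ toℕ j)
                                          ∧ dom (σ ⟨$⟩ʳ l) (σ ⟨$⟩ʳ j)))
  where open Tournament T

-- Embed A greedily along σ: position 0 receives the root, and position j receives an unembedded child
-- of the node at the least earlier position a such that that node still has an unembedded child and v_a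
-- dominates v_j; if there is no such a, position j is skipped.  Parents then precede and dominate their
-- children, so it suffices that every node gets embedded.  Give each non-root node weight 1, plus 1 if it
-- is an out-leaf: the total is n + k - 1 = m, the positions after the first use m - 1 - #skips + #leaves of
-- it, and an unembedded node whose parent is embedded leaves at least 2 unused.  So it is enough that skips
-- never outnumber embedded leaves.  Cut the positions after the node at p into windows at nodes that are
-- still open; in a window after p with no open node, every skip is a vertex not dominated by v_p, by the
-- local median property there are at most as many of those as dominated ones, and every dominated position
-- holds a node whose parent lies at or before p, hence roots a subtree of the window ending in a leaf.

module Submission where

open import Defs
open import Level using (Level)
open import Data.Bool using (Bool; true; false; _∧_) renaming (T to IsTrue)
open import Data.Bool.Properties using (T-≡)
open import Data.Fin using (Fin; zero; suc; toℕ; punchIn)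
open import Data.Fin.Permutation using (Permutation′; _⟨$⟩ʳ_; _⟨$⟩ˡ_; inverseˡ)
open import Data.Fin.Properties using (any?; ¬∀⟶∃¬; punchInᵢ≢i; nonZeroIndex) renaming (_≟_ to _≟ᶠ_)
open import Data.List using (length; filter; tabulate)
open import Data.Maybe using (Maybe; just; nothing; maybe)
open import Data.Maybe.Properties using (just-injective) renaming (≡-dec to ≡-decᵐ)
open import Data.Nat using (ℕ; zero; suc; _+_; _*_; _∸_; _≤_; _<_; z≤n; s≤s; z<s; _<ᵇ_; _≤ᵇ_; >-nonZero⁻¹)
open import Data.Nat.Induction using (<-wellFounded)
open import Data.Nat.Properties
open import Data.Product using (Σ; ∃; _×_; _,_; proj₁; proj₂)
open import Data.Sum using (_⊎_; inj₁; inj₂; [_,_]′)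
open import Function using (_∘_; _∘′_; _$_; Equivalence)
open import Function.Definitions using (Injective)
open import Induction.WellFounded using (Acc; acc)
open import Relation.Nullary using (¬_; Dec; yes; no; does)
open import Relation.Nullary.Decidable using (¬?; _×-dec_; T?; dec-true; dec-false; map′; decidable-stable; toSum)
open import Relation.Nullary.Negation using (contradiction)
open import Relation.Unary using (Pred; Decidable)
open import Relation.Binary.Definitions using (tri<; tri≈; tri>)
open import Relation.Binary.PropositionalEquality
open import Algebra.Properties.CommutativeSemigroup +-commutativeSemigroup using (interchange; xy∙z≈xz∙y)
open import Algebra.Properties.CommutativeMonoid.Sum +-0-commutativeMonoid
  using (sum; sum-cong-≗; sum-remove; sum-replicate-zero; ∑-distrib-+)

private variable
  ℓ ℓ′ : Level
  P : Set ℓ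
  Q : Set ℓ′

iverson : Bool → ℕ
iverson true  = 1
iverson false = 0

𝟙 : Dec P → ℕ
𝟙 P? = iverson (does P?)

𝟙-yes : (P? : Dec P) → P → 𝟙 P? ≡ 1
𝟙-yes P? x rewrite dec-true P? x = refl

𝟙-no : (P? : Dec P) → ¬ P → 𝟙 P? ≡ 0
𝟙-no P? ¬x rewrite dec-false P? ¬x = refl

𝟙≤1 : (P? : Dec P) → 𝟙 P? ≤ 1
𝟙≤1 (yes _) = ≤-refl
𝟙≤1 (no _)  = z≤n

𝟙-mono : (P? : Dec P) (Q? : Dec Q) → (P → Q) → 𝟙 P? ≤ 𝟙 Q?
𝟙-mono (yes x) Q? f = ≤-reflexive (sym (𝟙-yes Q? (f x)))
𝟙-mono (no _)  Q? f = z≤n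

𝟙-cong : (P? : Dec P) (Q? : Dec Q) → (P → Q) → (Q → P) → 𝟙 P? ≡ 𝟙 Q?
𝟙-cong P? Q? f g = ≤-antisym (𝟙-mono P? Q? f) (𝟙-mono Q? P? g)

𝟙-complement : (P? : Dec P) → 𝟙 P? + 𝟙 (¬? P?) ≡ 1
𝟙-complement (yes _) = refl
𝟙-complement (no _)  = refl

just≢nothing : ∀ {a} {A : Set a} {u : A} → just u ≢ nothing
just≢nothing ()

maybe-cases : ∀ {a} {A : Set a} (x : Maybe A) → x ≡ nothing ⊎ ∃ λ u → x ≡ just u
maybe-cases nothing  = inj₁ refl
maybe-cases (just u) = inj₂ (u , refl)

justWith? : ∀ {a} {A : Set a} {P : Pred A ℓ} → Decidable P → (x : Maybe A) → Dec (∃ λ u → x ≡ just u × P u)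
justWith? P? nothing  = no λ ()
justWith? P? (just u) = map′ (λ Pu → u , refl , Pu) (λ { (_ , refl , Pu) → Pu }) (P? u)

leastBelow? : ∀ {P : Pred ℕ ℓ} → Decidable P → ∀ j →
              (∀ {a} → a < j → ¬ P a) ⊎ ∃ λ a → a < j × P a × (∀ {a′} → a′ < a → ¬ P a′)
leastBelow? P? zero = inj₁ λ ()
leastBelow? P? (suc j) with leastBelow? P? j
... | inj₂ (a , a<j , Pa , minimal) = inj₂ (a , m<n⇒m<1+n a<j , Pa , minimal)
... | inj₁ none with P? j
...   | yes Pj = inj₂ (j , ≤-refl , Pj , none)
...   | no ¬Pj = inj₁ λ a<1+j → [ none , (λ { refl → ¬Pj }) ]′ (m<1+n⇒m<n∨m≡n a<1+j)

sumAfter : (ℕ → ℕ) → ℕ → ℕ → ℕ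
sumAfter f p zero    = 0
sumAfter f p (suc d) = f (suc p) + sumAfter f (suc p) d

InWindow : ℕ → ℕ → ℕ → Set
InWindow p d j = p < j × j ≤ p + d

window-head : ∀ {p d} → InWindow p (suc d) (suc p)
window-head {p} {d} = ≤-refl , ≤-trans (s≤s (m≤m+n p d)) (≤-reflexive (sym (+-suc p d)))

window-tail : ∀ {p d j} → InWindow (suc p) d j → InWindow p (suc d) j
window-tail {p} {d} (p<j , j≤) = <⇒≤ p<j , ≤-trans j≤ (≤-reflexive (sym (+-suc p d)))

window-split : ∀ {p d j} → InWindow p (suc d) j → j ≡ suc p ⊎ InWindow (suc p) d j
window-split {p} {d} (p<j , j≤) with m≤n⇒m<n∨m≡n p<j
... | inj₂ refl = inj₁ refl
... | inj₁ sp<j = inj₂ (sp<j , ≤-trans j≤ (≤-reflexive (+-suc p d)))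

window-any? : ∀ {P : Pred ℕ ℓ} → Decidable P → ∀ p d →
              (∀ {j} → InWindow p d j → ¬ P j) ⊎ ∃ λ j → InWindow p d j × P j
window-any? P? p zero = inj₁ λ (p<j , j≤p+0) _ → <⇒≱ p<j (≤-trans j≤p+0 (≤-reflexive (+-identityʳ p)))
window-any? P? p (suc d) with P? (suc p) | window-any? P? (suc p) d
... | yes P[p+1] | _                  = inj₂ (suc p , window-head , P[p+1])
... | no _       | inj₂ (j , w , Pj)  = inj₂ (j , window-tail w , Pj)
... | no ¬P[p+1] | inj₁ none          = inj₁ λ w → [ (λ { refl → ¬P[p+1] }) , none ]′ (window-split w)

module _ {f g : ℕ → ℕ} where

  sumAfter-cong : ∀ p d → (∀ {j} → InWindow p d j → f j ≡ g j) → sumAfter f p d ≡ sumAfter g p d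
  sumAfter-cong p zero    eq = refl
  sumAfter-cong p (suc d) eq = cong₂ _+_ (eq window-head) (sumAfter-cong (suc p) d (eq ∘ window-tail))

  sumAfter-mono : ∀ p d → (∀ {j} → InWindow p d j → f j ≤ g j) → sumAfter f p d ≤ sumAfter g p d
  sumAfter-mono p zero    le = z≤n
  sumAfter-mono p (suc d) le = +-mono-≤ (le window-head) (sumAfter-mono (suc p) d (le ∘ window-tail))

  sumAfter-distrib-+ : ∀ p d → sumAfter (λ j → f j + g j) p d ≡ sumAfter f p d + sumAfter g p d
  sumAfter-distrib-+ p zero    = refl
  sumAfter-distrib-+ p (suc d) = begin
    (f (suc p) + g (suc p)) + sumAfter (λ j → f j + g j) (suc p) d
      ≡⟨ cong (f (suc p) + g (suc p) +_) (sumAfter-distrib-+ (suc p) d) ⟩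
    (f (suc p) + g (suc p)) + (sumAfter f (suc p) d + sumAfter g (suc p) d)
      ≡⟨ interchange (f (suc p)) (g (suc p)) _ _ ⟩
    (f (suc p) + sumAfter f (suc p) d) + (g (suc p) + sumAfter g (suc p) d) ∎
    where open ≡-Reasoning

  sumAfter-mono-except : ∀ a p d → (∀ j → f j ≤ 1) → (∀ {j} → InWindow p d j → j ≢ a → f j ≤ g j) →
                         sumAfter f p d ≤ sumAfter g p d + 1
  sumAfter-mono-except a p zero    f≤1 le = z≤n
  sumAfter-mono-except a p (suc d) f≤1 le with suc p ≟ a
  ... | yes refl = begin
    f (suc p) + sumAfter f (suc p) d
      ≤⟨ +-mono-≤ (f≤1 (suc p)) (sumAfter-mono (suc p) d λ w → le (window-tail w) (>⇒≢ (proj₁ w))) ⟩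
    1 + sumAfter g (suc p) d
      ≤⟨ +-monoʳ-≤ 1 (m≤n+m _ (g (suc p))) ⟩
    1 + (g (suc p) + sumAfter g (suc p) d)
      ≡⟨ +-comm 1 _ ⟩
    (g (suc p) + sumAfter g (suc p) d) + 1 ∎
    where open ≤-Reasoning
  ... | no p+1≢a = begin
    f (suc p) + sumAfter f (suc p) d
      ≤⟨ +-mono-≤ (le window-head p+1≢a) (sumAfter-mono-except a (suc p) d f≤1 (le ∘ window-tail)) ⟩
    g (suc p) + (sumAfter g (suc p) d + 1)
      ≡⟨ +-assoc (g (suc p)) _ 1 ⟨
    (g (suc p) + sumAfter g (suc p) d) + 1 ∎
    where open ≤-Reasoning

sumAfter-const : ∀ {f} c p d → (∀ {j} → InWindow p d j → f j ≡ c) → sumAfter f p d ≡ d * c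
sumAfter-const c p zero    eq = refl
sumAfter-const c p (suc d) eq = cong₂ _+_ (eq window-head) (sumAfter-const c (suc p) d (eq ∘ window-tail))

sumAfter-zero : ∀ {f} p d → (∀ {j} → InWindow p d j → f j ≡ 0) → sumAfter f p d ≡ 0
sumAfter-zero p d eq = trans (sumAfter-const 0 p d eq) (*-zeroʳ d)

sumAfter-++ : ∀ f p d e → sumAfter f p (d + e) ≡ sumAfter f p d + sumAfter f (p + d) e
sumAfter-++ f p zero    e rewrite +-identityʳ p = refl
sumAfter-++ f p (suc d) e rewrite +-suc p d =
  trans (cong (f (suc p) +_) (sumAfter-++ f (suc p) d e)) (sym (+-assoc (f (suc p)) _ _))

sumAfter-snoc : ∀ f p d → sumAfter f p (suc d) ≡ sumAfter f p d + f (suc (p + d))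
sumAfter-snoc f p d = begin
  sumAfter f p (suc d)                   ≡⟨ cong (sumAfter f p) (+-comm 1 d) ⟩
  sumAfter f p (d + 1)                   ≡⟨ sumAfter-++ f p d 1 ⟩
  sumAfter f p d + (f (suc (p + d)) + 0) ≡⟨ cong (sumAfter f p d +_) (+-identityʳ _) ⟩
  sumAfter f p d + f (suc (p + d))       ∎
  where open ≡-Reasoning

sumAfter-around : ∀ f p e d → sumAfter f p (suc e + d) ≡ sumAfter f p e + f (suc (p + e)) + sumAfter f (suc (p + e)) d
sumAfter-around f p e d = begin
  sumAfter f p (suc e + d)                                    ≡⟨ sumAfter-++ f p (suc e) d ⟩
  sumAfter f p (suc e) + sumAfter f (p + suc e) d
    ≡⟨ cong₂ _+_ (sumAfter-snoc f p e) (cong (λ q → sumAfter f q d) (+-suc p e)) ⟩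
  sumAfter f p e + f (suc (p + e)) + sumAfter f (suc (p + e)) d ∎
  where open ≡-Reasoning

sumAfter-shift : ∀ f p d → sumAfter (f ∘ suc) p d ≡ sumAfter f (suc p) d
sumAfter-shift f p zero    = refl
sumAfter-shift f p (suc d) = cong (f (suc (suc p)) +_) (sumAfter-shift f (suc p) d)

sum-mono : ∀ {n} {f g : Fin n → ℕ} → (∀ i → f i ≤ g i) → sum f ≤ sum g
sum-mono {zero}  le = z≤n
sum-mono {suc n} le = +-mono-≤ (le zero) (sum-mono (λ i → le (suc i)))

sum-ones : ∀ n → sum {n} (λ _ → 1) ≡ n
sum-ones zero    = refl
sum-ones (suc n) = cong suc (sum-ones n)

sum-indicator-≟ : ∀ {n} (i : Fin n) → sum (λ j → 𝟙 (j ≟ᶠ i)) ≡ 1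
sum-indicator-≟ {suc n} i = begin
  sum (λ j → 𝟙 (j ≟ᶠ i))                            ≡⟨ sum-remove {i = i} (λ j → 𝟙 (j ≟ᶠ i)) ⟩
  𝟙 (i ≟ᶠ i) + sum (λ j → 𝟙 (punchIn i j ≟ᶠ i))    ≡⟨ cong₂ _+_ (𝟙-yes (i ≟ᶠ i) refl)
                                                         (sum-cong-≗ λ j → 𝟙-no (punchIn i j ≟ᶠ i) (punchInᵢ≢i i j)) ⟩
  1 + sum {n} (λ _ → 0)                             ≡⟨ cong suc (sum-replicate-zero n) ⟩
  1                                                 ∎
  where open ≡-Reasoning

sum-toℕ : ∀ M (f : ℕ → ℕ) → sum {suc M} (λ i → f (toℕ i)) ≡ f 0 + sumAfter f 0 M
sum-toℕ zero    f = refl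
sum-toℕ (suc M) f = cong (f 0 +_) (trans (sum-toℕ M (f ∘ suc)) (cong (f 1 +_) (sumAfter-shift f 0 M)))

sum-insert : ∀ {n} {f g : Fin n → ℕ} i → (∀ j → j ≢ i → g j ≡ f j) → f i ≡ 0 → sum g ≡ sum f + g i
sum-insert {suc n} {f} {g} i g≗f f[i]≡0 = begin
  sum g                                 ≡⟨ sum-remove {i = i} g ⟩
  g i + sum (λ j → g (punchIn i j))     ≡⟨ cong (g i +_) (sum-cong-≗ λ j → g≗f _ (punchInᵢ≢i i j)) ⟩
  g i + sum (λ j → f (punchIn i j))     ≡⟨ +-comm (g i) _ ⟩
  sum (λ j → f (punchIn i j)) + g i     ≡⟨ cong (λ x → x + sum (λ j → f (punchIn i j)) + g i) f[i]≡0 ⟨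
  f i + sum (λ j → f (punchIn i j)) + g i ≡⟨ cong (_+ g i) (sum-remove {i = i} f) ⟨
  sum f + g i                           ∎
  where open ≡-Reasoning

sum-deficit : ∀ {n} {f g : Fin n → ℕ} i δ → (∀ j → g j ≤ f j) → g i + δ ≤ f i → sum g + δ ≤ sum f
sum-deficit {suc n} {f} {g} i δ g≤f deficit = begin
  sum g + δ                                   ≡⟨ cong (_+ δ) (sum-remove {i = i} g) ⟩
  g i + sum (λ j → g (punchIn i j)) + δ       ≡⟨ xy∙z≈xz∙y (g i) _ δ ⟩
  g i + δ + sum (λ j → g (punchIn i j))       ≤⟨ +-mono-≤ deficit (sum-mono (g≤f ∘ punchIn i)) ⟩
  f i + sum (λ j → f (punchIn i j))           ≡⟨ sum-remove {i = i} f ⟨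
  sum f                                       ∎
  where open ≤-Reasoning

sum-deficit₂ : ∀ {n} {f g : Fin n → ℕ} i j → i ≢ j → (∀ k → g k ≤ f k) →
               g i + 1 ≤ f i → g j + 1 ≤ f j → sum g + 2 ≤ sum f
sum-deficit₂ {f = f} {g} i j i≢j g≤f deficitᵢ deficitⱼ = begin
  sum g + 2                              ≡⟨ +-assoc (sum g) 1 1 ⟨
  sum g + 1 + 1                          ≡⟨ cong (λ x → sum g + x + 1) (sum-indicator-≟ j) ⟨
  sum g + sum (λ k → 𝟙 (k ≟ᶠ j)) + 1    ≡⟨ cong (_+ 1) (∑-distrib-+ g (λ k → 𝟙 (k ≟ᶠ j))) ⟨
  sum g′ + 1                             ≤⟨ sum-deficit i 1 g′≤f g′ᵢ+1≤fᵢ ⟩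
  sum f                                  ∎
  where
  open ≤-Reasoning
  g′ : Fin _ → ℕ
  g′ k = g k + 𝟙 (k ≟ᶠ j)
  g′≤f : ∀ k → g′ k ≤ f k
  g′≤f k with k ≟ᶠ j
  ... | yes refl = deficitⱼ
  ... | no _     = ≤-trans (≤-reflexive (+-identityʳ (g k))) (g≤f k)
  g′ᵢ+1≤fᵢ : g′ i + 1 ≤ f i
  g′ᵢ+1≤fᵢ rewrite 𝟙-no (i ≟ᶠ j) i≢j | +-identityʳ (g i) = deficitᵢ

length-filter-tabulate : ∀ {a} {A : Set a} {P : Pred A ℓ} (P? : Decidable P) {n} (f : Fin n → A) →
                         length (filter P? (tabulate f)) ≡ sum (λ i → 𝟙 (P? (f i)))
length-filter-tabulate P? {zero}  f = refl
length-filter-tabulate P? {suc n} f with does (P? (f zero))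
... | true  = cong suc (length-filter-tabulate P? (λ i → f (suc i)))
... | false = length-filter-tabulate P? (λ i → f (suc i))

module _ {n} (A : OutArborescence n) where
  open OutArborescence A

  nonLeaf-child : ∀ {c} → c ≢ root → ¬ IsOutLeaf A c → ∃ λ d → d ≢ root × parent d ≡ c
  nonLeaf-child {c} c≢r ¬leaf with ¬∀⟶∃¬ n _ (λ w → ¬? (arc? A c w)) (λ noArc → ¬leaf (c≢r , noArc))
  ... | d , ¬¬arc = d , decidable-stable (arc? A c d) ¬¬arc

  iter-suc : ∀ {B : Set} k (f : B → B) x → iter (suc k) f x ≡ iter k f (f x)
  iter-suc zero    f x = refl
  iter-suc (suc k) f x = cong f (iter-suc k f x)

  weight : Fin n → ℕ
  weight c = 1 + 𝟙 (isOutLeaf? A c)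

  nonRootWeight : Fin n → ℕ
  nonRootWeight c = 𝟙 (¬? (c ≟ᶠ root)) * weight c

  nonRootWeight-split : ∀ c → nonRootWeight c ≡ 𝟙 (¬? (c ≟ᶠ root)) + 𝟙 (isOutLeaf? A c)
  nonRootWeight-split c with toSum (c ≟ᶠ root)
  ... | inj₁ c≡r = begin
    𝟙 (¬? (c ≟ᶠ root)) * weight c               ≡⟨ cong (_* weight c) (𝟙-no (¬? (c ≟ᶠ root)) (_$ c≡r)) ⟩
    0                                           ≡⟨ cong₂ _+_ (𝟙-no (¬? (c ≟ᶠ root)) (_$ c≡r))
                                                             (𝟙-no (isOutLeaf? A c) ((_$ c≡r) ∘′ proj₁)) ⟨
    𝟙 (¬? (c ≟ᶠ root)) + 𝟙 (isOutLeaf? A c)     ∎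
    where open ≡-Reasoning
  ... | inj₂ c≢r = begin
    𝟙 (¬? (c ≟ᶠ root)) * weight c               ≡⟨ cong (_* weight c) (𝟙-yes (¬? (c ≟ᶠ root)) c≢r) ⟩
    weight c + 0                                ≡⟨ +-identityʳ (weight c) ⟩
    1 + 𝟙 (isOutLeaf? A c)                      ≡⟨ cong (_+ 𝟙 (isOutLeaf? A c)) (𝟙-yes (¬? (c ≟ᶠ root)) c≢r) ⟨
    𝟙 (¬? (c ≟ᶠ root)) + 𝟙 (isOutLeaf? A c)     ∎
    where open ≡-Reasoning

  nonRootWeight-total : sum nonRootWeight + 1 ≡ n + numOutLeaves A
  nonRootWeight-total = begin
    sum nonRootWeight + 1                                  ≡⟨ cong (_+ 1) (sum-cong-≗ nonRootWeight-split) ⟩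
    sum (λ c → 𝟙 (¬? (c ≟ᶠ root)) + 𝟙 (isOutLeaf? A c)) + 1
      ≡⟨ cong (_+ 1) (∑-distrib-+ (λ c → 𝟙 (¬? (c ≟ᶠ root))) _) ⟩
    nonRoots + leaves + 1                                  ≡⟨ xy∙z≈xz∙y nonRoots leaves 1 ⟩
    nonRoots + 1 + leaves                                  ≡⟨ cong₂ _+_ (trans (+-comm nonRoots 1) nodes) leafCount ⟩
    n + numOutLeaves A                                     ∎
    where
    open ≡-Reasoning
    nonRoots = sum (λ c → 𝟙 (¬? (c ≟ᶠ root)))
    leaves   = sum (λ c → 𝟙 (isOutLeaf? A c))
    nodes : 1 + nonRoots ≡ n
    nodes = begin
      1 + nonRoots                                         ≡⟨ cong (_+ nonRoots) (sum-indicator-≟ root) ⟨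
      sum (λ c → 𝟙 (c ≟ᶠ root)) + nonRoots                 ≡⟨ ∑-distrib-+ (λ c → 𝟙 (c ≟ᶠ root)) _ ⟨
      sum (λ c → 𝟙 (c ≟ᶠ root) + 𝟙 (¬? (c ≟ᶠ root)))       ≡⟨ sum-cong-≗ (λ c → 𝟙-complement (c ≟ᶠ root)) ⟩
      sum {n} (λ _ → 1)                                    ≡⟨ sum-ones n ⟩
      n                                                    ∎
    leafCount : leaves ≡ numOutLeaves A
    leafCount = sym (length-filter-tabulate (isOutLeaf? A) (λ c → c))

  nonRootWeight-fits : ∀ {m′} → suc m′ ≡ n + numOutLeaves A ∸ 1 → sum nonRootWeight ≡ suc m′
  nonRootWeight-fits {m′} size = +-cancelʳ-≡ 1 _ _ (begin
    sum nonRootWeight + 1             ≡⟨ nonRootWeight-total ⟩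
    n + numOutLeaves A                ≡⟨ m∸n+n≡m (≤-trans (>-nonZero⁻¹ n {{nonZeroIndex root}}) (m≤m+n n _)) ⟨
    n + numOutLeaves A ∸ 1 + 1        ≡⟨ cong (_+ 1) size ⟨
    suc m′ + 1                        ∎)
    where open ≡-Reasoning

module Greedy {n} (A : OutArborescence n) (_▷_ : ℕ → ℕ → Set) (_▷?_ : ∀ a j → Dec (a ▷ j)) where
  open OutArborescence A

  Assignment : Set
  Assignment = ℕ → Maybe (Fin n)

  PlacedBefore : Assignment → ℕ → Fin n → Set
  PlacedBefore g j c = ∃ λ b → b < j × g b ≡ just c

  placedBefore? : ∀ g j c → Dec (PlacedBefore g j c)
  placedBefore? g j c = anyUpTo? (λ b → ≡-decᵐ _≟ᶠ_ (g b) (just c)) j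

  Pending : Assignment → ℕ → Fin n → Fin n → Set
  Pending g j u c = c ≢ root × parent c ≡ u × ¬ PlacedBefore g j c

  pending? : ∀ g j u c → Dec (Pending g j u c)
  pending? g j u c = ¬? (c ≟ᶠ root) ×-dec (parent c ≟ᶠ u) ×-dec ¬? (placedBefore? g j c)

  Open : Assignment → ℕ → Fin n → Set
  Open g j u = ∃ (Pending g j u)

  open? : ∀ g j u → Dec (Open g j u)
  open? g j u = any? (pending? g j u)

  Candidate : Assignment → ℕ → ℕ → Set
  Candidate g j a = (∃ λ u → g a ≡ just u × Open g j u) × a ▷ j

  candidate? : ∀ g j a → Dec (Candidate g j a)
  candidate? g j a = justWith? (open? g j) (g a) ×-dec (a ▷? j)

  data Step (g : Assignment) (j : ℕ) : Maybe (Fin n) → Set where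
    skip  : (∀ {a} → a < j → ¬ Candidate g j a) → Step g j nothing
    place : ∀ {a u c} → a < j → g a ≡ just u → Pending g j u c → a ▷ j →
            (∀ {a′} → a′ < a → ¬ Candidate g j a′) → Step g j (just c)

  step : ∀ g j → ∃ (Step g j)
  step g j with leastBelow? (candidate? g j) j
  ... | inj₁ none = nothing , skip none
  ... | inj₂ (a , a<j , ((u , ga , c , pending) , a▷j) , minimal) = just c , place a<j ga pending a▷j minimal

  run : ℕ → Assignment
  run zero    zero    = just root
  run zero    (suc _) = nothing
  run (suc t) b with b ≟ suc t
  ... | yes _ = proj₁ (step (run t) (suc t))
  ... | no  _ = run t b

  node : Assignment
  node b = run b b

  run-stable : ∀ {t b} → b ≤ t → run t b ≡ node b
  run-stable {t} {b} b≤t with m≤n⇒m<n∨m≡n b≤t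
  ... | inj₂ refl = refl
  run-stable {suc t} {b} _ | inj₁ (s≤s b≤t) with b ≟ suc t
  ... | yes refl = contradiction b≤t (<⇒≱ ≤-refl)
  ... | no _     = run-stable b≤t

  -- A step at j only inspects positions below j, so it may be computed from run t instead of node.
  AgreeBelow : ℕ → Assignment → Assignment → Set
  AgreeBelow j g g′ = ∀ {b} → b < j → g b ≡ g′ b

  agreeBelow-sym : ∀ {j g g′} → AgreeBelow j g g′ → AgreeBelow j g′ g
  agreeBelow-sym agree b<j = sym (agree b<j)

  placedBefore-transfer : ∀ {j g g′ c} → AgreeBelow j g g′ → PlacedBefore g j c → PlacedBefore g′ j c
  placedBefore-transfer agree (b , b<j , gb) = b , b<j , trans (sym (agree b<j)) gb

  pending-transfer : ∀ {j g g′ u c} → AgreeBelow j g g′ → Pending g j u c → Pending g′ j u c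
  pending-transfer agree (c≢r , pc , unplaced) =
    c≢r , pc , unplaced ∘′ placedBefore-transfer (agreeBelow-sym agree)

  candidate-transfer : ∀ {j g g′ a} → AgreeBelow j g g′ → a < j → Candidate g j a → Candidate g′ j a
  candidate-transfer agree a<j ((u , ga , c , pending) , a▷j) =
    (u , trans (sym (agree a<j)) ga , c , pending-transfer agree pending) , a▷j

  step-transfer : ∀ {j g g′ x} → AgreeBelow j g g′ → Step g j x → Step g′ j x
  step-transfer agree (skip none) = skip λ a<j → none a<j ∘′ candidate-transfer (agreeBelow-sym agree) a<j
  step-transfer agree (place a<j ga pending a▷j minimal) =
    place a<j (trans (sym (agree a<j)) ga) (pending-transfer agree pending) a▷j
          (λ a′<a → minimal a′<a ∘′ candidate-transfer (agreeBelow-sym agree) (<-trans a′<a a<j))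

  node-step : ∀ t → Step node (suc t) (node (suc t))
  node-step t with suc t ≟ suc t
  ... | yes _   = step-transfer (λ b<1+t → run-stable (≤-pred b<1+t)) (proj₂ (step (run t) (suc t)))
  ... | no ≢1+t = contradiction refl ≢1+t

  placed-step : ∀ t {c} → node (suc t) ≡ just c → Step node (suc t) (just c)
  placed-step t eq = subst (Step node (suc t)) eq (node-step t)

  skipped-step : ∀ t → node (suc t) ≡ nothing → Step node (suc t) nothing
  skipped-step t eq = subst (Step node (suc t)) eq (node-step t)

  node-fresh : ∀ b {c} → node b ≡ just c → ¬ PlacedBefore node b c
  node-fresh zero    _  (_ , () , _)
  node-fresh (suc t) eq with placed-step t eq
  ... | place _ _ (_ , _ , unplaced) _ _ = unplaced

  node-injective : ∀ a b {c} → node a ≡ just c → node b ≡ just c → a ≡ b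
  node-injective a b na nb with <-cmp a b
  ... | tri< a<b _ _ = contradiction (a , a<b , na) (node-fresh b nb)
  ... | tri≈ _ a≡b _ = a≡b
  ... | tri> _ _ b<a = contradiction (b , b<a , nb) (node-fresh a na)

  node-parent : ∀ t {c} → node (suc t) ≡ just c →
                c ≢ root × ∃ λ a → a < suc t × node a ≡ just (parent c) × a ▷ suc t
  node-parent t eq with placed-step t eq
  ... | place a<j na (c≢r , pc≡u , _) a▷j _ = c≢r , _ , a<j , trans na (cong just (sym pc≡u)) , a▷j

  parent-before-child : ∀ a b {c} → node b ≡ just c → c ≢ root → node a ≡ just (parent c) → a < b × a ▷ b
  parent-before-child a zero    nb c≢r _  = contradiction (just-injective nb) (c≢r ∘′ sym)
  parent-before-child a (suc t) nb c≢r na with node-parent t nb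
  ... | _ , a′ , a′<b , na′ , a′▷b with node-injective a a′ na na′
  ...   | refl = a′<b , a′▷b

  placedBefore-mono : ∀ {g j j′ c} → j′ ≤ j → PlacedBefore g j′ c → PlacedBefore g j c
  placedBefore-mono j′≤j (b , b<j′ , gb) = b , <-≤-trans b<j′ j′≤j , gb

  placedBefore-suc : ∀ {g j c} → PlacedBefore g (suc j) c → PlacedBefore g j c ⊎ g j ≡ just c
  placedBefore-suc (b , s≤s b≤j , gb) with m≤n⇒m<n∨m≡n b≤j
  ... | inj₁ b<j  = inj₁ (b , b<j , gb)
  ... | inj₂ refl = inj₂ gb

  open-antitone : ∀ {g j j′ u} → j′ ≤ j → Open g j u → Open g j′ u
  open-antitone j′≤j (c , c≢r , pc , unplaced) = c , c≢r , pc , unplaced ∘′ placedBefore-mono j′≤j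

  open-persists : ∀ t {u} → (∀ {c} → node (suc t) ≡ just c → parent c ≢ u) →
                  Open node (suc t) u → Open node (suc (suc t)) u
  open-persists t notParent (c , c≢r , pc , unplaced) =
    c , c≢r , pc , [ unplaced , (λ nc → notParent nc pc) ]′ ∘′ placedBefore-suc

  open-new : ∀ t {c} → node (suc t) ≡ just c → ¬ IsOutLeaf A c → Open node (suc (suc t)) c
  open-new t nc ¬leaf with nonLeaf-child A (proj₁ (node-parent t nc)) ¬leaf
  ... | d , d≢r , pd = d , d≢r , pd , λ (b , b<2+t , nd) →
    <⇒≱ (proj₁ (parent-before-child (suc t) b nd d≢r (subst (λ x → node (suc t) ≡ just x) (sym pd) nc)))
        (≤-pred b<2+t)

  Skipped : ℕ → Set
  Skipped j = node j ≡ nothing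

  skipped? : ∀ j → Dec (Skipped j)
  skipped? j = ≡-decᵐ _≟ᶠ_ (node j) nothing

  LeafAt : ℕ → Set
  LeafAt j = ∃ λ c → node j ≡ just c × IsOutLeaf A c

  leafAt? : ∀ j → Dec (LeafAt j)
  leafAt? j = justWith? (isOutLeaf? A) (node j)

  OpenAt : ℕ → ℕ → Set
  OpenAt t j = ∃ λ u → node j ≡ just u × Open node (suc t) u

  openAt? : ∀ t j → Dec (OpenAt t j)
  openAt? t j = justWith? (open? node (suc t)) (node j)

  ParentPlacedBy : ℕ → ℕ → Set
  ParentPlacedBy p j = ∃ λ c → node j ≡ just c × PlacedBefore node (suc p) (parent c)

  parentPlacedBy? : ∀ p j → Dec (ParentPlacedBy p j)
  parentPlacedBy? p j = justWith? (λ c → placedBefore? node (suc p) (parent c)) (node j)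

  skips : ℕ → ℕ → ℕ
  skips = sumAfter (λ j → 𝟙 (skipped? j))

  leaves : ℕ → ℕ → ℕ
  leaves = sumAfter (λ j → 𝟙 (leafAt? j))

  opens : ℕ → ℕ → ℕ → ℕ
  opens t = sumAfter (λ j → 𝟙 (openAt? t j))

  openAt-persists : ∀ t j → (∀ {c} → node (suc t) ≡ just c → node j ≢ just (parent c)) →
                    OpenAt t j → OpenAt (suc t) j
  openAt-persists t j notParent (u , nj , open-u) =
    u , nj , open-persists t (λ nc pc≡u → notParent nc (trans nj (cong just (sym pc≡u)))) open-u

  openAt-persists-apart : ∀ t a j {c} → node (suc t) ≡ just c → node a ≡ just (parent c) → j ≢ a →
                          OpenAt t j → OpenAt (suc t) j
  openAt-persists-apart t a j {c} nc na j≢a = openAt-persists t j λ nc′ nj →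
    j≢a (node-injective j a (trans nj (cong (just ∘′ parent) (just-injective (trans (sym nc′) nc)))) na)

  new-node-counted : ∀ t {c} → node (suc t) ≡ just c → 1 ≤ 𝟙 (leafAt? (suc t)) + 𝟙 (openAt? (suc t) (suc t))
  new-node-counted t {c} nc with isOutLeaf? A c
  ... | yes leaf = ≤-trans (≤-reflexive (sym (𝟙-yes (leafAt? (suc t)) (c , nc , leaf)))) (m≤m+n _ _)
  ... | no ¬leaf = ≤-trans (≤-reflexive (sym (𝟙-yes (openAt? (suc t) (suc t)) (c , nc , open-new t nc ¬leaf))))
                           (m≤n+m _ _)

  opens-step-placed : ∀ t p d {c} → node (suc t) ≡ just c →
                      opens t p d + 𝟙 (parentPlacedBy? p (suc t)) ≤ opens (suc t) p d + 1
  opens-step-placed t p d {c} nc with node-parent t nc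
  ... | _ , a , _ , na , _ with parentPlacedBy? p (suc t)
  ...   | yes (c′ , nc′ , b , b<1+p , nb) = +-monoˡ-≤ 1 (sumAfter-mono p d λ {j} (p<j , _) →
            𝟙-mono (openAt? t j) (openAt? (suc t) j)
                   (openAt-persists-apart t a j nc na λ { refl → <⇒≱ p<j (≤-pred (subst (_< suc p) b≡a b<1+p)) }))
    where
    b≡a : b ≡ a
    b≡a = node-injective b a (trans nb (cong (just ∘′ parent) (just-injective (trans (sym nc′) nc)))) na
  ...   | no _ = ≤-trans (≤-reflexive (+-identityʳ _))
                         (sumAfter-mono-except a p d (λ j → 𝟙≤1 (openAt? t j))
                            (λ {j} _ j≢a → 𝟙-mono (openAt? t j) (openAt? (suc t) j)
                                                  (openAt-persists-apart t a j nc na j≢a)))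

  opens-step : ∀ t p d → opens t p d + 𝟙 (parentPlacedBy? p (suc t)) ≤
                         opens (suc t) p d + (𝟙 (leafAt? (suc t)) + 𝟙 (openAt? (suc t) (suc t)))
  opens-step t p d with maybe-cases (node (suc t))
  ... | inj₁ skipped = begin
    opens t p d + 𝟙 (parentPlacedBy? p (suc t))
      ≡⟨ cong (opens t p d +_) (𝟙-no (parentPlacedBy? p (suc t)) λ (_ , nc , _) → nothing≢just nc) ⟩
    opens t p d + 0                              ≡⟨ +-identityʳ _ ⟩
    opens t p d                                  ≤⟨ sumAfter-mono p d (λ {j} _ → 𝟙-mono (openAt? t j) (openAt? (suc t) j)
                                                                (openAt-persists t j (λ nc _ → nothing≢just nc))) ⟩
    opens (suc t) p d                            ≤⟨ m≤m+n _ _ ⟩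
    opens (suc t) p d + _                        ∎
    where
    open ≤-Reasoning
    nothing≢just : ∀ {c} → node (suc t) ≢ just c
    nothing≢just nc with trans (sym skipped) nc
    ... | ()
  ... | inj₂ (c , nc) = begin
    opens t p d + 𝟙 (parentPlacedBy? p (suc t)) ≤⟨ opens-step-placed t p d nc ⟩
    opens (suc t) p d + 1                        ≤⟨ +-monoʳ-≤ _ (new-node-counted t nc) ⟩
    opens (suc t) p d + _                        ∎
    where open ≤-Reasoning

  -- A node in the window whose parent lies at or before p roots a subtree inside the window, and that
  -- subtree contains a leaf or a node that is still open.
  parentsPlacedBy≤leaves+opens : ∀ p d →
    sumAfter (λ j → 𝟙 (parentPlacedBy? p j)) p d ≤ leaves p d + opens (p + d) p d
  parentsPlacedBy≤leaves+opens p zero    = z≤n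
  parentsPlacedBy≤leaves+opens p (suc d) rewrite +-suc p d = begin
    sumAfter R p (suc d)                       ≡⟨ sumAfter-snoc R p d ⟩
    sumAfter R p d + r                         ≤⟨ +-monoˡ-≤ r (parentsPlacedBy≤leaves+opens p d) ⟩
    leaves p d + opens t p d + r               ≡⟨ +-assoc (leaves p d) _ r ⟩
    leaves p d + (opens t p d + r)             ≤⟨ +-monoʳ-≤ (leaves p d) (opens-step t p d) ⟩
    leaves p d + (opens (suc t) p d + (l + o)) ≡⟨ +-assoc (leaves p d) _ _ ⟨
    leaves p d + opens (suc t) p d + (l + o)   ≡⟨ interchange (leaves p d) _ l o ⟩
    (leaves p d + l) + (opens (suc t) p d + o) ≡⟨ cong₂ _+_ (sumAfter-snoc _ p d) (sumAfter-snoc _ p d) ⟨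
    leaves p (suc d) + opens (suc t) p (suc d) ∎
    where
    open ≤-Reasoning
    t = p + d
    R = λ j → 𝟙 (parentPlacedBy? p j)
    r = 𝟙 (parentPlacedBy? p (suc t))
    l = 𝟙 (leafAt? (suc t))
    o = 𝟙 (openAt? (suc t) (suc t))

  parent-placed-before : ∀ b {d} → node b ≡ just d → d ≢ root → PlacedBefore node b (parent d)
  parent-placed-before zero    nd d≢r = contradiction (just-injective nd) (d≢r ∘′ sym)
  parent-placed-before (suc t) nd d≢r with node-parent t nd
  ... | _ , a , a<b , na , _ = a , a<b , na

  unplaced-frontier : ∀ {g j u} → PlacedBefore g j root → ¬ PlacedBefore g j u →
                      ∃ λ c → c ≢ root × ¬ PlacedBefore g j c × PlacedBefore g j (parent c)
  unplaced-frontier {g} {j} {u} rootPlaced = descend (proj₁ (reaches u)) u (proj₂ (reaches u))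
    where
    descend : ∀ k v → iter k parent v ≡ root → ¬ PlacedBefore g j v →
              ∃ λ c → c ≢ root × ¬ PlacedBefore g j c × PlacedBefore g j (parent c)
    descend zero    v v≡r unplaced = contradiction (subst (PlacedBefore g j) (sym v≡r) rootPlaced) unplaced
    descend (suc k) v reach unplaced with placedBefore? g j (parent v)
    ... | yes parentPlaced =
      v , (λ v≡r → unplaced (subst (PlacedBefore g j) (sym v≡r) rootPlaced)) , unplaced , parentPlaced
    ... | no parentUnplaced = descend k (parent v) (trans (sym (iter-suc A k parent v)) reach) parentUnplaced

  positionWeight : ℕ → ℕ
  positionWeight j = maybe (weight A) 0 (node j)

  skipped+positionWeight : ∀ j → 𝟙 (skipped? j) + positionWeight j ≡ 1 + 𝟙 (leafAt? j)
  skipped+positionWeight j = byCase (node j)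
    where
    byCase : ∀ x → 𝟙 (≡-decᵐ _≟ᶠ_ x nothing) + maybe (weight A) 0 x ≡ 1 + 𝟙 (justWith? (isOutLeaf? A) x)
    byCase nothing  = refl
    byCase (just c) = refl

  skips+positionWeights : ∀ t → skips 0 t + sumAfter positionWeight 0 t ≡ t + leaves 0 t
  skips+positionWeights t = begin
    skips 0 t + sumAfter positionWeight 0 t                  ≡⟨ sumAfter-distrib-+ 0 t ⟨
    sumAfter (λ j → 𝟙 (skipped? j) + positionWeight j) 0 t    ≡⟨ sumAfter-cong 0 t (λ {j} _ → skipped+positionWeight j) ⟩
    sumAfter (λ j → 1 + 𝟙 (leafAt? j)) 0 t                  ≡⟨ sumAfter-distrib-+ 0 t ⟩
    sumAfter (λ _ → 1) 0 t + leaves 0 t                      ≡⟨ cong (_+ leaves 0 t) (sumAfter-const 1 0 t λ _ → refl) ⟩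
    t * 1 + leaves 0 t                                       ≡⟨ cong (_+ leaves 0 t) (*-identityʳ t) ⟩
    t + leaves 0 t                                           ∎
    where open ≡-Reasoning

  placedNonRoot? : ∀ j c → Dec (c ≢ root × PlacedBefore node j c)
  placedNonRoot? j c = ¬? (c ≟ᶠ root) ×-dec placedBefore? node j c

  placedWeight : ℕ → Fin n → ℕ
  placedWeight j c = 𝟙 (placedNonRoot? j c) * weight A c

  placedWeight≤nonRootWeight : ∀ j c → placedWeight j c ≤ nonRootWeight A c
  placedWeight≤nonRootWeight j c = *-monoˡ-≤ (weight A c) (𝟙-mono (placedNonRoot? j c) (¬? (c ≟ᶠ root)) proj₁)

  placedWeight-unplaced : ∀ j {c} → c ≢ root → ¬ PlacedBefore node j c →
                          placedWeight j c + weight A c ≡ nonRootWeight A c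
  placedWeight-unplaced j {c} c≢r unplaced = begin
    placedWeight j c + weight A c  ≡⟨ cong (λ x → x * weight A c + weight A c) (𝟙-no (placedNonRoot? j c) (unplaced ∘′ proj₂)) ⟩
    weight A c                     ≡⟨ +-identityʳ (weight A c) ⟨
    1 * weight A c                 ≡⟨ cong (_* weight A c) (𝟙-yes (¬? (c ≟ᶠ root)) c≢r) ⟨
    nonRootWeight A c              ∎
    where open ≡-Reasoning

  placedWeight-unchanged : ∀ t c → node (suc t) ≢ just c → placedWeight (suc (suc t)) c ≡ placedWeight (suc t) c
  placedWeight-unchanged t c notHere = cong (_* weight A c) (𝟙-cong (placedNonRoot? (suc (suc t)) c) (placedNonRoot? (suc t) c)
    (λ (c≢r , placed) → c≢r , [ (λ before → before) , (λ nc → contradiction nc notHere) ]′ (placedBefore-suc placed))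
    (λ (c≢r , placed) → c≢r , placedBefore-mono (n≤1+n _) placed))

  placedWeights-step : ∀ t → sum (placedWeight (suc (suc t))) ≡ sum (placedWeight (suc t)) + positionWeight (suc t)
  placedWeights-step t with maybe-cases (node (suc t))
  ... | inj₁ skipped = begin
    sum (placedWeight (suc (suc t)))
      ≡⟨ sum-cong-≗ (λ c → placedWeight-unchanged t c λ nc → just≢nothing (trans (sym nc) skipped)) ⟩
    sum (placedWeight (suc t))                               ≡⟨ +-identityʳ _ ⟨
    sum (placedWeight (suc t)) + 0
      ≡⟨ cong (λ x → sum (placedWeight (suc t)) + maybe (weight A) 0 x) skipped ⟨
    sum (placedWeight (suc t)) + positionWeight (suc t)      ∎
    where open ≡-Reasoning
  ... | inj₂ (c₀ , nc₀) = begin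
    sum (placedWeight (suc (suc t)))
      ≡⟨ sum-insert c₀ (λ c c≢c₀ → placedWeight-unchanged t c λ nc → c≢c₀ (just-injective (trans (sym nc) nc₀))) before ⟩
    sum (placedWeight (suc t)) + placedWeight (suc (suc t)) c₀ ≡⟨ cong (sum (placedWeight (suc t)) +_) now ⟩
    sum (placedWeight (suc t)) + positionWeight (suc t)      ∎
    where
    open ≡-Reasoning
    c₀≢r = proj₁ (node-parent t nc₀)
    before : placedWeight (suc t) c₀ ≡ 0
    before = cong (_* weight A c₀) (𝟙-no (placedNonRoot? (suc t) c₀) (node-fresh (suc t) nc₀ ∘′ proj₂))
    now : placedWeight (suc (suc t)) c₀ ≡ positionWeight (suc t)
    now = begin
      placedWeight (suc (suc t)) c₀
        ≡⟨ cong (_* weight A c₀) (𝟙-yes (placedNonRoot? (suc (suc t)) c₀) (c₀≢r , suc t , ≤-refl , nc₀)) ⟩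
      weight A c₀ + 0                ≡⟨ +-identityʳ _ ⟩
      weight A c₀                    ≡⟨ cong (maybe (weight A) 0) nc₀ ⟨
      positionWeight (suc t)         ∎

  positionWeights≡placedWeights : ∀ t → sumAfter positionWeight 0 t ≡ sum (placedWeight (suc t))
  positionWeights≡placedWeights zero = sym (trans (sum-cong-≗ nothingPlacedYet) (sum-replicate-zero n))
    where
    nothingPlacedYet : ∀ c → placedWeight 1 c ≡ 0
    nothingPlacedYet c = cong (_* weight A c) (𝟙-no (placedNonRoot? 1 c)
                           λ { (c≢r , zero , _ , n0) → c≢r (sym (just-injective n0)) ; (_ , suc _ , s≤s () , _) })
  positionWeights≡placedWeights (suc t) = begin
    sumAfter positionWeight 0 (suc t)                      ≡⟨ sumAfter-snoc positionWeight 0 t ⟩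
    sumAfter positionWeight 0 t + positionWeight (suc t)   ≡⟨ cong (_+ positionWeight (suc t)) (positionWeights≡placedWeights t) ⟩
    sum (placedWeight (suc t)) + positionWeight (suc t)    ≡⟨ placedWeights-step t ⟨
    sum (placedWeight (suc (suc t)))                       ∎
    where open ≡-Reasoning

  unplaced-deficit : ∀ j {c} → c ≢ root → ¬ PlacedBefore node j c → PlacedBefore node j (parent c) →
                     sum (placedWeight j) + 2 ≤ sum (nonRootWeight A)
  unplaced-deficit j {c} c≢r unplaced parentPlaced with toSum (isOutLeaf? A c)
  ... | inj₁ leaf = sum-deficit c 2 (placedWeight≤nonRootWeight j) (≤-reflexive (begin
    placedWeight j c + 2           ≡⟨ cong (λ x → placedWeight j c + suc x) (𝟙-yes (isOutLeaf? A c) leaf) ⟨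
    placedWeight j c + weight A c  ≡⟨ placedWeight-unplaced j c≢r unplaced ⟩
    nonRootWeight A c              ∎))
    where open ≡-Reasoning
  ... | inj₂ ¬leaf with nonLeaf-child A c≢r ¬leaf
  ...   | d , d≢r , pd = sum-deficit₂ c d c≢d (placedWeight≤nonRootWeight j) (gap c≢r unplaced) (gap d≢r d-unplaced)
    where
    gap : ∀ {x} → x ≢ root → ¬ PlacedBefore node j x → placedWeight j x + 1 ≤ nonRootWeight A x
    gap {x} x≢r x-unplaced =
      ≤-trans (+-monoʳ-≤ (placedWeight j x) (s≤s z≤n)) (≤-reflexive (placedWeight-unplaced j x≢r x-unplaced))
    d-unplaced : ¬ PlacedBefore node j d
    d-unplaced (b , b<j , nd) =
      unplaced (placedBefore-mono (<⇒≤ b<j) (subst (PlacedBefore node b) pd (parent-placed-before b nd d≢r)))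
    c≢d : c ≢ d
    c≢d c≡d = unplaced (subst (PlacedBefore node j) (trans (cong parent c≡d) pd) parentPlaced)

  module Counting (m′ : ℕ)
                  (median : ∀ p d → p + d ≤ m′ → d ≤ 2 * sumAfter (λ j → 𝟙 (p ▷? j)) p d) where

    nonBeaten≤beaten : ∀ p d → p + d ≤ m′ →
                       sumAfter (λ j → 𝟙 (¬? (p ▷? j))) p d ≤ sumAfter (λ j → 𝟙 (p ▷? j)) p d
    nonBeaten≤beaten p d bound = +-cancelˡ-≤ beaten _ _ (begin
      beaten + nonBeaten ≡⟨ sumAfter-distrib-+ p d ⟨
      sumAfter (λ j → 𝟙 (p ▷? j) + 𝟙 (¬? (p ▷? j))) p d ≡⟨ sumAfter-const 1 p d (λ {j} _ → 𝟙-complement (p ▷? j)) ⟩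
      d * 1                                               ≡⟨ *-identityʳ d ⟩
      d                                                   ≤⟨ median p d bound ⟩
      beaten + (beaten + 0)                               ≡⟨ cong (beaten +_) (+-identityʳ beaten) ⟩
      beaten + beaten                                     ∎)
      where
      open ≤-Reasoning
      beaten    = sumAfter (λ j → 𝟙 (p ▷? j)) p d
      nonBeaten = sumAfter (λ j → 𝟙 (¬? (p ▷? j))) p d

    skipped⇒¬▷ : ∀ {p x} t → node p ≡ just x → p < suc t → Open node (suc t) x →
                 Skipped (suc t) → ¬ p ▷ suc t
    skipped⇒¬▷ t np p<j open-x skipped p▷j with skipped-step t skipped
    ... | skip none = none p<j ((_ , np , open-x) , p▷j)

    ▷⇒parentPlacedBy : ∀ {p x} t → node p ≡ just x → p < suc t → Open node (suc t) x → p ▷ suc t →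
                       ParentPlacedBy p (suc t)
    ▷⇒parentPlacedBy t np p<j open-x p▷j with maybe-cases (node (suc t))
    ... | inj₁ skipped = contradiction p▷j (skipped⇒¬▷ t np p<j open-x skipped)
    ... | inj₂ (c , nc) with placed-step t nc
    ...   | place {a} _ na (_ , pc≡u , _) _ minimal =
            c , nc , a , s≤s (≮⇒≥ λ p<a → minimal p<a ((_ , np , open-x) , p▷j)) , trans na (cong just (sym pc≡u))

    open-in-window : ∀ {p d t x} → InWindow p d (suc t) → Open node (suc (p + d)) x → Open node (suc t) x
    open-in-window (_ , 1+t≤p+d) = open-antitone (s≤s (≤-trans (n≤1+n _) 1+t≤p+d))

    skips≤leaves-closed : ∀ {p x} d → node p ≡ just x → Open node (suc (p + d)) x → p + d ≤ m′ →
                          (∀ {j} → InWindow p d j → ¬ OpenAt (p + d) j) → skips p d ≤ leaves p d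
    skips≤leaves-closed {p} d np open-x bound closed = begin
      skips p d                                          ≤⟨ sumAfter-mono p d skip⇒nonBeaten ⟩
      sumAfter (λ j → 𝟙 (¬? (p ▷? j))) p d               ≤⟨ nonBeaten≤beaten p d bound ⟩
      sumAfter (λ j → 𝟙 (p ▷? j)) p d                    ≤⟨ sumAfter-mono p d beaten⇒parentPlacedBy ⟩
      sumAfter (λ j → 𝟙 (parentPlacedBy? p j)) p d       ≤⟨ parentsPlacedBy≤leaves+opens p d ⟩
      leaves p d + opens (p + d) p d
        ≡⟨ cong (leaves p d +_) (sumAfter-zero p d λ {j} w → 𝟙-no (openAt? (p + d) j) (closed w)) ⟩
      leaves p d + 0                                     ≡⟨ +-identityʳ _ ⟩
      leaves p d                                         ∎
      where
      open ≤-Reasoning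
      skip⇒nonBeaten : ∀ {j} → InWindow p d j → 𝟙 (skipped? j) ≤ 𝟙 (¬? (p ▷? j))
      skip⇒nonBeaten {suc t} w = 𝟙-mono (skipped? (suc t)) (¬? (p ▷? suc t))
                                   (skipped⇒¬▷ t np (proj₁ w) (open-in-window w open-x))
      beaten⇒parentPlacedBy : ∀ {j} → InWindow p d j → 𝟙 (p ▷? j) ≤ 𝟙 (parentPlacedBy? p j)
      beaten⇒parentPlacedBy {suc t} w = 𝟙-mono (p ▷? suc t) (parentPlacedBy? p (suc t))
                                          (▷⇒parentPlacedBy t np (proj₁ w) (open-in-window w open-x))

    skips≤leaves-++ : ∀ p e f → skips p e ≤ leaves p e → ¬ Skipped (suc (p + e)) →
                      skips (suc (p + e)) f ≤ leaves (suc (p + e)) f → skips p (suc e + f) ≤ leaves p (suc e + f)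
    skips≤leaves-++ p e f left occupied right = begin
      skips p (suc e + f)                                        ≡⟨ sumAfter-around _ p e f ⟩
      skips p e + 𝟙 (skipped? (suc (p + e))) + skips (suc (p + e)) f
        ≤⟨ +-mono-≤ (+-mono-≤ left (≤-reflexive (𝟙-no (skipped? (suc (p + e))) occupied))) right ⟩
      leaves p e + 0 + leaves (suc (p + e)) f                    ≤⟨ +-monoˡ-≤ _ (+-monoʳ-≤ (leaves p e) z≤n) ⟩
      leaves p e + 𝟙 (leafAt? (suc (p + e))) + leaves (suc (p + e)) f ≡⟨ sumAfter-around _ p e f ⟨
      leaves p (suc e + f)                                       ∎
      where open ≤-Reasoning

    window-decompose : ∀ {p q d} → p < q → q ≤ p + d → ∃ λ e → ∃ λ f → q ≡ suc (p + e) × d ≡ suc e + f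
    window-decompose {p} {q} {d} p<q q≤p+d = q ∸ suc p , p + d ∸ q , sym q≡ , +-cancelˡ-≡ p d _ (begin
      p + d                         ≡⟨ m+[n∸m]≡n q≤p+d ⟨
      q + (p + d ∸ q)               ≡⟨ cong (_+ (p + d ∸ q)) q≡ ⟨
      suc (p + (q ∸ suc p)) + (p + d ∸ q) ≡⟨ +-assoc (suc p) (q ∸ suc p) _ ⟩
      suc p + (q ∸ suc p + (p + d ∸ q))   ≡⟨ +-suc p _ ⟨
      p + (suc (q ∸ suc p) + (p + d ∸ q)) ∎)
      where
      open ≡-Reasoning
      q≡ : suc (p + (q ∸ suc p)) ≡ q
      q≡ = m+[n∸m]≡n p<q

    window-skips≤leaves : ∀ {p x} d → Acc _<_ d → node p ≡ just x → Open node (suc (p + d)) x → p + d ≤ m′ →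
                          skips p d ≤ leaves p d
    window-skips≤leaves {p} d (acc smaller) np open-x bound with window-any? (openAt? (p + d)) p d
    ... | inj₁ closed = skips≤leaves-closed d np open-x bound closed
    ... | inj₂ (q , (p<q , q≤p+d) , z , nq , open-z) with window-decompose p<q q≤p+d
    ...   | e , f , refl , refl =
            skips≤leaves-++ p e f
              (window-skips≤leaves e (smaller (s≤s (m≤m+n e f))) np (open-antitone (s≤s p+e≤) open-x)
                                   (≤-trans p+e≤ bound))
              (λ skipped → just≢nothing (trans (sym nq) skipped))
              (window-skips≤leaves f (smaller (s≤s (m≤n+m f e))) nq (subst (λ k → Open node (suc k) z) regroup open-z)
                                   (subst (_≤ m′) regroup bound))
      where
      p+e≤ : p + e ≤ p + (suc e + f)
      p+e≤ = +-monoʳ-≤ p (≤-trans (n≤1+n e) (m≤m+n (suc e) f))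
      regroup : p + (suc e + f) ≡ suc (p + e) + f
      regroup = trans (sym (+-assoc p (suc e) f)) (cong (_+ f) (+-suc p e))

    -- The parent of the node at p was open when p was filled, so induct back along parents to position 0.
    prefix-skips≤leaves : ∀ {x t} p → Acc _<_ p → node p ≡ just x → p ≤ t → Open node (suc t) x → t ≤ m′ →
                          skips 0 t ≤ leaves 0 t
    prefix-skips≤leaves {t = t} zero _ np _ open-x bound = window-skips≤leaves t (<-wellFounded t) np open-x bound
    prefix-skips≤leaves {x} (suc p) (acc smaller) np p≤t open-x bound
      with node-parent p np | m≤n⇒∃[o]m+o≡n p≤t
    ... | x≢r , a , a<1+p , na , _ | f , refl =
      skips≤leaves-++ 0 p f
        (prefix-skips≤leaves a (smaller a<1+p) na (≤-pred a<1+p) (x , x≢r , refl , node-fresh (suc p) np)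
                             (≤-trans (n≤1+n p) (≤-trans (m≤m+n (suc p) f) bound)))
        (λ skipped → just≢nothing (trans (sym np) skipped))
        (window-skips≤leaves f (<-wellFounded f) np open-x bound)

    placedWeights-lower-bound : ∀ t → skips 0 t ≤ leaves 0 t → t ≤ sum (placedWeight (suc t))
    placedWeights-lower-bound t balanced = ≤-trans (+-cancelʳ-≤ (leaves 0 t) t _ (begin
      t + leaves 0 t                          ≡⟨ skips+positionWeights t ⟨
      skips 0 t + sumAfter positionWeight 0 t ≤⟨ +-monoˡ-≤ _ balanced ⟩
      leaves 0 t + sumAfter positionWeight 0 t ≡⟨ +-comm (leaves 0 t) _ ⟩
      sumAfter positionWeight 0 t + leaves 0 t ∎)) (≤-reflexive (positionWeights≡placedWeights t))
      where open ≤-Reasoning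

    all-placed : sum (nonRootWeight A) ≡ suc m′ → ∀ u → PlacedBefore node (suc m′) u
    all-placed total u with placedBefore? node (suc m′) u
    ... | yes placed = placed
    ... | no unplaced with unplaced-frontier (0 , s≤s z≤n , refl) unplaced
    ...   | c , c≢r , c-unplaced , p , p<1+m′ , np = contradiction tooHeavy 1+n≰n
      where
      balanced : skips 0 m′ ≤ leaves 0 m′
      balanced = prefix-skips≤leaves p (<-wellFounded p) np (≤-pred p<1+m′) (c , c≢r , refl , c-unplaced) ≤-refl
      tooHeavy : suc (suc m′) ≤ suc m′
      tooHeavy = begin
        suc (suc m′)                       ≡⟨ +-comm m′ 2 ⟨
        m′ + 2                             ≤⟨ +-monoˡ-≤ 2 (placedWeights-lower-bound m′ balanced) ⟩
        sum (placedWeight (suc m′)) + 2    ≤⟨ unplaced-deficit (suc m′) c≢r c-unplaced (p , p<1+m′ , np) ⟩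
        sum (nonRootWeight A)              ≡⟨ total ⟩
        suc m′                             ∎
        where open ≤-Reasoning

count≡sum : ∀ {M} (f : Fin M → Bool) → count f ≡ sum (λ i → iverson (f i))
count≡sum f = trans (length-filter-tabulate (λ x → f x Data.Bool.≟ true) (λ i → i))
                    (sum-cong-≗ (λ i → ≟true (f i)))
  where
  ≟true : ∀ b → 𝟙 (b Data.Bool.≟ true) ≡ iverson b
  ≟true true  = refl
  ≟true false = refl

count-cong : ∀ {M} {f g : Fin M → Bool} → (∀ l → f l ≡ g l) → count f ≡ count g
count-cong {f = f} {g} f≗g = trans (count≡sum f) (trans (sum-cong-≗ (cong iverson ∘ f≗g)) (sym (count≡sum g)))

count-window : ∀ M p d (b : ℕ → Bool) → p + d ≤ M →
               count {suc M} (λ l → (p <ᵇ toℕ l) ∧ (toℕ l ≤ᵇ p + d) ∧ b (toℕ l))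
                 ≡ sumAfter (λ j → iverson (b j)) p d
count-window M p d b p+d≤M = begin
  count {suc M} (λ l → does (inWindow? (toℕ l)))          ≡⟨ count≡sum {suc M} (λ l → does (inWindow? (toℕ l))) ⟩
  sum {suc M} (λ l → 𝟙 (inWindow? (toℕ l)))               ≡⟨ sum-toℕ M (λ j → 𝟙 (inWindow? j)) ⟩
  sumAfter g 0 M                                          ≡⟨ cong (sumAfter g 0) M≡ ⟨
  sumAfter g 0 (p + (d + e))                              ≡⟨ sumAfter-++ g 0 p (d + e) ⟩
  sumAfter g 0 p + sumAfter g p (d + e)                   ≡⟨ cong (sumAfter g 0 p +_) (sumAfter-++ g p d e) ⟩
  sumAfter g 0 p + (sumAfter g p d + sumAfter g (p + d) e) ≡⟨ cong₂ _+_ before (cong₂ _+_ inside after) ⟩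
  0 + (sumAfter (λ j → iverson (b j)) p d + 0)            ≡⟨ +-identityʳ _ ⟩
  sumAfter (λ j → iverson (b j)) p d                      ∎
  where
  open ≡-Reasoning
  inWindow? : ∀ j → Dec (p < j × j ≤ p + d × IsTrue (b j))
  inWindow? j = (p <? j) ×-dec (j ≤? p + d) ×-dec T? (b j)
  g = λ j → 𝟙 (inWindow? j)
  e = M ∸ (p + d)
  M≡ : p + (d + e) ≡ M
  M≡ = trans (sym (+-assoc p d e)) (m+[n∸m]≡n p+d≤M)
  before : sumAfter g 0 p ≡ 0
  before = sumAfter-zero 0 p λ {j} (_ , j≤p) → 𝟙-no (inWindow? j) λ (p<j , _) → <⇒≱ p<j j≤p
  inside : sumAfter g p d ≡ sumAfter (λ j → iverson (b j)) p d
  inside = sumAfter-cong p d λ {j} (p<j , j≤p+d) →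
    𝟙-cong (inWindow? j) (T? (b j)) (proj₂ ∘ proj₂) (λ bj → p<j , j≤p+d , bj)
  after : sumAfter g (p + d) e ≡ 0
  after = sumAfter-zero (p + d) e λ {j} (p+d<j , _) → 𝟙-no (inWindow? j) λ (_ , j≤p+d , _) → <⇒≱ p+d<j j≤p+d

-- clamp M j = min j M; only positions j ≤ M are ever used.
clamp : ∀ M → ℕ → Fin (suc M)
clamp M       zero    = zero
clamp zero    (suc j) = zero
clamp (suc M) (suc j) = suc (clamp M j)

toℕ-clamp : ∀ {M j} → j ≤ M → toℕ (clamp M j) ≡ j
toℕ-clamp {M}     {zero}  _         = refl
toℕ-clamp {suc M} {suc j} (s≤s j≤M) = cong suc (toℕ-clamp j≤M)

clamp-toℕ : ∀ {M} (i : Fin (suc M)) → clamp M (toℕ i) ≡ i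
clamp-toℕ {M}     zero    = refl
clamp-toℕ {suc M} (suc i) = cong suc (clamp-toℕ i)

module AlongOrder {m′} (T : Tournament (suc m′)) (σ : Permutation′ (suc m′)) where
  open Tournament T

  vertexAt : ℕ → Fin (suc m′)
  vertexAt j = σ ⟨$⟩ʳ clamp m′ j

  beats : ℕ → ℕ → Bool
  beats a j = dom (vertexAt a) (vertexAt j)

  forward-median : IsLocalMedianOrder T σ →
                   ∀ p d → p + d ≤ m′ → d ≤ 2 * sumAfter (λ j → iverson (beats p j)) p d
  forward-median med p zero    _     = z≤n
  forward-median med p (suc d) bound = subst₂ _≤_ span (cong (2 *_) outNeighbours) (proj₁ (med i j i<j))
    where
    i = clamp m′ p
    j = clamp m′ (p + suc d)
    toℕ-i : toℕ i ≡ p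
    toℕ-i = toℕ-clamp (≤-trans (m≤m+n p (suc d)) bound)
    toℕ-j : toℕ j ≡ p + suc d
    toℕ-j = toℕ-clamp bound
    i<j : toℕ i < toℕ j
    i<j = subst₂ _<_ (sym toℕ-i) (sym toℕ-j) (m<m+n p z<s)
    span : toℕ j ∸ toℕ i ≡ suc d
    span = trans (cong₂ _∸_ toℕ-j toℕ-i) (m+n∸m≡n p (suc d))
    outNeighbours : count (λ l → (toℕ i <ᵇ toℕ l) ∧ (toℕ l ≤ᵇ toℕ j) ∧ dom (σ ⟨$⟩ʳ i) (σ ⟨$⟩ʳ l))
                    ≡ sumAfter (λ j → iverson (beats p j)) p (suc d)
    outNeighbours = trans (count-cong pointwise) (count-window m′ p (suc d) (beats p) bound)
      where
      pointwise : ∀ l → (toℕ i <ᵇ toℕ l) ∧ (toℕ l ≤ᵇ toℕ j) ∧ dom (σ ⟨$⟩ʳ i) (σ ⟨$⟩ʳ l)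
                        ≡ (p <ᵇ toℕ l) ∧ (toℕ l ≤ᵇ p + suc d) ∧ beats p (toℕ l)
      pointwise l rewrite toℕ-i | toℕ-j | clamp-toℕ l = refl

  module Embedding {n} (A : OutArborescence n) (med : IsLocalMedianOrder T σ)
                   (fits : sum (nonRootWeight A) ≡ suc m′) where
    open OutArborescence A
    open Greedy A (λ a j → IsTrue (beats a j)) (λ a j → T? (beats a j))
    open Counting m′ (forward-median med)

    position : Fin n → ℕ
    position u = proj₁ (all-placed fits u)

    position≤m′ : ∀ u → position u ≤ m′
    position≤m′ u = ≤-pred (proj₁ (proj₂ (all-placed fits u)))

    node-position : ∀ u → node (position u) ≡ just u
    node-position u = proj₂ (proj₂ (all-placed fits u))

    φ : Fin n → Fin (suc m′)
    φ u = vertexAt (position u)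

    φ-injective : Injective _≡_ _≡_ φ
    φ-injective {u} {v} φu≡φv =
      just-injective (trans (sym (node-position u)) (trans (cong node samePosition) (node-position v)))
      where
      sameSlot : clamp m′ (position u) ≡ clamp m′ (position v)
      sameSlot = trans (sym (inverseˡ σ)) (trans (cong (σ ⟨$⟩ˡ_) φu≡φv) (inverseˡ σ))
      samePosition : position u ≡ position v
      samePosition = trans (sym (toℕ-clamp (position≤m′ u))) (trans (cong toℕ sameSlot) (toℕ-clamp (position≤m′ v)))

    φ-preserves-arcs : ∀ u v → Arc A u v → dom (φ u) (φ v) ≡ true
    φ-preserves-arcs u v (v≢r , pv≡u) = Equivalence.to T-≡ (proj₂ (parent-before-child (position u) (position v)
      (node-position v) v≢r (subst (λ w → node (position u) ≡ just w) (sym pv≡u) (node-position u))))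

    φ-root : φ root ≡ σ ⟨$⟩ʳ zero
    φ-root = cong vertexAt (node-injective (position root) 0 (node-position root) refl)

mainTheorem7 : (n k m' : ℕ) (A : OutArborescence n) → numOutLeaves A ≡ k →
    suc m' ≡ n + k ∸ 1 →
    (T : Tournament (suc m')) (σ : Permutation′ (suc m')) → IsLocalMedianOrder T σ →
    Σ (Fin n → Fin (suc m')) λ φ →
      Injective _≡_ _≡_ φ
      × (∀ u v → Arc A u v → Tournament.dom T (φ u) (φ v) ≡ true)
      × (φ (OutArborescence.root A) ≡ σ ⟨$⟩ʳ zero)
mainTheorem7 n _ m' A refl size T σ med = φ , φ-injective , φ-preserves-arcs , φ-root
  where open AlongOrder.Embedding T σ A med (nonRootWeight-fits A size)
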